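{- For integers $n,k$ with $n\ge 2$ and $1\le k\le 2^{n-1}$, $$\sum_{i=1}^{k} i!\,\left\{{k \atop i}\right\}\,\tau_{n,i}=(2^k-1)(2^k-2)\cdots(2^k-n+1).$$
   Context: A bipartition of a set $S$ is a partition of $S$ into at most two nonempty components (so the trivial partition $\{S\}$ is a bipartition). A bipartition cuts two elements if they lie in different components. A family of bipartitions of $S$ is a separating family for $S$ if every two distinct elements of $S$ are cut by some bipartition in the family. $\tau_{n,i}$ denotes the number of separating families consisting of $i$ (distinct) arbitrary bipartitions of a fixed $n$-element set. $\left\{{k \atop i}\right\}$ denotes the Stirling number of the second kind (number of partitions of a $k$-element set into $i$ nonempty blocks). -}

module Defs where

open import Data.Nat using (ℕ; zero; suc; _+_; _*_; _∸_; _^_; _!)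
open import Data.Bool using (Bool; true; false)
import Data.Bool.Properties as BoolP
open import Data.Fin using (Fin; zero; suc)
import Data.Fin.Properties as FinP
open import Data.Vec using (Vec; []; _∷_; lookup)
open import Data.List using (List; []; _∷_; [_]; map; _++_; filter; length)
open import Data.List.Relation.Unary.Any using (Any; any?)
open import Relation.Binary.PropositionalEquality using (_≡_; _≢_)
open import Relation.Nullary using (Dec; ¬?)
open import Relation.Nullary.Decidable using (_→-dec_)

-- Encoding of bipartitions of the n-element set Fin (suc m):
-- a bipartition {A, B} (at most two nonempty blocks, unordered) is
-- represented canonically by the indicator of the block NOT containing
-- element 0: element 0 always gets side false, element (suc j) gets
-- side (lookup v j).  Every v : Vec Bool m gives a distinct bipartition
-- (v all-false = the trivial partition), and every bipartition arises
-- exactly once, so Vec Bool m is in bijection with the bipartitions.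
Bip : ℕ → Set
Bip m = Vec Bool m

side : ∀ {m} → Bip m → Fin (suc m) → Bool
side v zero    = false
side v (suc j) = lookup v j

Cuts : ∀ {m} → Bip m → Fin (suc m) → Fin (suc m) → Set
Cuts b x y = side b x ≢ side b y

Separating : ∀ {m} → List (Bip m) → Set
Separating {m} F = ∀ (x y : Fin (suc m)) → x ≢ y → Any (λ b → Cuts b x y) F

separating? : ∀ {m} (F : List (Bip m)) → Dec (Separating F)
separating? F =
  FinP.all? λ x → FinP.all? λ y →
    ¬? (x FinP.≟ y) →-dec any? (λ b → ¬? (side b x BoolP.≟ side b y)) F

allVec : (m : ℕ) → List (Vec Bool m)
allVec zero    = [ [] ]
allVec (suc m) = map (false ∷_) (allVec m) ++ map (true ∷_) (allVec m)

-- all sub-lists of length i (i-element subsets when the list has no repeats)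
combinations : {A : Set} → ℕ → List A → List (List A)
combinations zero    _        = [ [] ]
combinations (suc i) []       = []
combinations (suc i) (x ∷ xs) = map (x ∷_) (combinations i xs) ++ combinations (suc i) xs

-- τ_{m+1,i}: number of separating families of i distinct bipartitions
-- of a fixed (m+1)-element set
τ : ℕ → ℕ → ℕ
τ m i = length (filter separating? (combinations i (allVec m)))

S₂ : ℕ → ℕ → ℕ
S₂ zero    zero    = 1
S₂ zero    (suc i) = 0
S₂ (suc k) zero    = 0
S₂ (suc k) (suc i) = suc i * S₂ k (suc i) + S₂ k i

sum1 : ℕ → (ℕ → ℕ) → ℕ
sum1 zero    f = 0
sum1 (suc k) f = sum1 k f + f (suc k)

prod0 : ℕ → (ℕ → ℕ) → ℕ
prod0 zero    f = 1
prod0 (suc n) f = prod0 n f * f n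

-- Both sides count the k-tuples (B₁, …, B_k) of bipartitions, repetitions allowed, that
-- together separate the n-set. Grouping the tuples by their set of entries, a separating
-- family of i bipartitions is the set of entries of exactly i! {k i} tuples (the surjections
-- from the k positions onto it); this gives the left side. Read column-wise, a tuple gives
-- every element x the code (side of x in B₁, …, B_k) ∈ {0,1}^k, the element 0 has code 0…0,
-- and the tuple separates iff the codes are distinct; choosing the codes of the other n − 1
-- elements one at a time gives (2^k − 1)(2^k − 2)⋯(2^k − n + 1).
module Submission where

open import Algebra.Properties.CommutativeSemigroup using (interchange)
open import Data.Bool using (Bool; true; false; not; _∨_)
import Data.Bool.Properties as Bool
open import Data.Empty using (⊥-elim)
open import Data.Fin using (Fin; zero; suc; punchIn)
import Data.Fin.Properties as Fin
open import Data.List using (List; []; _∷_; [_]; _++_; map; concatMap; filter; length; tabulate; allFin)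
import Data.List as List
import Data.List.Membership.DecPropositional as DecMembership
open import Data.List.Membership.Propositional using (_∈_; _∉_)
open import Data.List.Membership.Propositional.Properties using (∈-tabulate⁺; ∈-tabulate⁻; ∈-map⁻)
open import Data.List.Properties using (map-tabulate; tabulate-lookup; length-tabulate)
open import Data.List.Relation.Binary.Subset.Propositional using (_⊆_)
open import Data.List.Relation.Binary.Subset.Propositional.Properties using (Any-resp-⊆)
open import Data.List.Relation.Unary.All.Properties using (All¬⇒¬Any)
open import Data.List.Relation.Unary.Any using (Any; here; there)
open import Data.List.Relation.Unary.Unique.Propositional using (Unique; _∷_)
open import Data.List.Relation.Unary.Unique.Propositional.Properties using (tabulate⁺)
open import Data.Nat using (ℕ; zero; suc; pred; _+_; _*_; _∸_; _^_; _!; _≤_; _<_; _≟_; _≤?_; z≤n; s≤s)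
open import Data.Nat.Properties
open import Data.Nat.Solver using (module +-*-Solver)
open import Data.Product using (∃-syntax; _×_; _,_)
open import Data.Vec using (Vec; []; _∷_; lookup; replicate; toList; zipWith; _[_]≔_)
import Data.Vec as Vec
open import Data.Vec.Membership.Propositional using () renaming (_∈_ to _∈ᵥ_)
open import Data.Vec.Relation.Unary.Any using () renaming (here to hereᵥ; there to thereᵥ)
open import Data.Vec.Membership.Propositional.Properties using (∈-map⁺; ∈-toList⁺; ∈-toList⁻)
open import Data.Vec.Properties
  using (≡-dec; ∷-injectiveˡ; ∷-injectiveʳ; lookup∘update; lookup∘update′; lookup-replicate; toList-map)
open import Function.Base using (_∘_; id)
open import Function.Bundles using (_⇔_; mk⇔)
open import Function.Definitions using (Injective)
open import Relation.Binary.Definitions using (DecidableEquality)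
open import Relation.Binary.PropositionalEquality hiding ([_])
open import Relation.Nullary using (Dec; yes; no; does)
open import Relation.Nullary.Decidable using (dec-true; dec-false; does-⇔)

open import Defs

𝟙 : Bool → ℕ
𝟙 true  = 1
𝟙 false = 0

∑ : {A : Set} → List A → (A → ℕ) → ℕ
∑ []       f = 0
∑ (x ∷ xs) f = f x + ∑ xs f

infix 6.5 ∑
syntax ∑ xs (λ x → e) = ∑[ x ∈ xs ] e

module _ {A : Set} where

  ∑-cong : (xs : List A) {f g : A → ℕ} → (∀ x → f x ≡ g x) → ∑ xs f ≡ ∑ xs g
  ∑-cong []       f≗g = refl
  ∑-cong (x ∷ xs) f≗g = cong₂ _+_ (f≗g x) (∑-cong xs f≗g)

  ∑-zero : (xs : List A) {f : A → ℕ} → (∀ x → f x ≡ 0) → ∑ xs f ≡ 0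
  ∑-zero []       f≗0 = refl
  ∑-zero (x ∷ xs) f≗0 = cong₂ _+_ (f≗0 x) (∑-zero xs f≗0)

  ∑-distrib-+ : (xs : List A) (f g : A → ℕ) → ∑[ x ∈ xs ] (f x + g x) ≡ ∑ xs f + ∑ xs g
  ∑-distrib-+ []       f g = refl
  ∑-distrib-+ (x ∷ xs) f g = trans (cong (f x + g x +_) (∑-distrib-+ xs f g))
                                   (interchange +-commutativeSemigroup (f x) (g x) (∑ xs f) (∑ xs g))

  ∑-*ˡ : (c : ℕ) (xs : List A) (f : A → ℕ) → ∑[ x ∈ xs ] (c * f x) ≡ c * ∑ xs f
  ∑-*ˡ c []       f = sym (*-zeroʳ c)
  ∑-*ˡ c (x ∷ xs) f = trans (cong (c * f x +_) (∑-*ˡ c xs f)) (sym (*-distribˡ-+ c (f x) (∑ xs f)))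

  ∑-*ʳ : (c : ℕ) (xs : List A) (f : A → ℕ) → ∑[ x ∈ xs ] (f x * c) ≡ ∑ xs f * c
  ∑-*ʳ c []       f = refl
  ∑-*ʳ c (x ∷ xs) f = trans (cong (f x * c +_) (∑-*ʳ c xs f)) (sym (*-distribʳ-+ c (f x) (∑ xs f)))

  ∑-++ : (xs ys : List A) (f : A → ℕ) → ∑ (xs ++ ys) f ≡ ∑ xs f + ∑ ys f
  ∑-++ []       ys f = refl
  ∑-++ (x ∷ xs) ys f = trans (cong (f x +_) (∑-++ xs ys f)) (sym (+-assoc (f x) _ _))

  length-filter : {P : A → Set} (P? : ∀ x → Dec (P x)) (xs : List A) →
                  length (filter P? xs) ≡ ∑[ x ∈ xs ] 𝟙 (does (P? x))
  length-filter P? []       = refl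
  length-filter P? (x ∷ xs) with does (P? x)
  ... | true  = cong suc (length-filter P? xs)
  ... | false = length-filter P? xs

module _ {A B : Set} where

  ∑-map : (g : A → B) (xs : List A) (f : B → ℕ) → ∑ (map g xs) f ≡ ∑[ x ∈ xs ] f (g x)
  ∑-map g []       f = refl
  ∑-map g (x ∷ xs) f = cong (f (g x) +_) (∑-map g xs f)

  ∑-concatMap : (g : A → List B) (xs : List A) (f : B → ℕ) → ∑ (concatMap g xs) f ≡ ∑[ x ∈ xs ] ∑ (g x) f
  ∑-concatMap g []       f = refl
  ∑-concatMap g (x ∷ xs) f = trans (∑-++ (g x) _ f) (cong (∑ (g x) f +_) (∑-concatMap g xs f))

  ∑-comm : (xs : List A) (ys : List B) (h : A → B → ℕ) →
           ∑[ x ∈ xs ] ∑[ y ∈ ys ] h x y ≡ ∑[ y ∈ ys ] ∑[ x ∈ xs ] h x y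
  ∑-comm []       ys h = sym (∑-zero ys (λ _ → refl))
  ∑-comm (x ∷ xs) ys h = trans (cong (∑ ys (h x) +_) (∑-comm xs ys h)) (sym (∑-distrib-+ ys (h x) _))

sum1-cong : (k : ℕ) {f g : ℕ → ℕ} → (∀ i → f i ≡ g i) → sum1 k f ≡ sum1 k g
sum1-cong zero    f≗g = refl
sum1-cong (suc k) f≗g = cong₂ _+_ (sum1-cong k f≗g) (f≗g (suc k))

sum1-*ʳ : (c k : ℕ) (f : ℕ → ℕ) → sum1 k (λ i → f i * c) ≡ sum1 k f * c
sum1-*ʳ c zero    f = refl
sum1-*ʳ c (suc k) f = trans (cong (_+ f (suc k) * c) (sum1-*ʳ c k f)) (sym (*-distribʳ-+ c (sum1 k f) _))

sum1-∑ : {A : Set} (k : ℕ) (xs : List A) (h : ℕ → A → ℕ) →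
         sum1 k (λ i → ∑[ x ∈ xs ] h i x) ≡ ∑[ x ∈ xs ] sum1 k (λ i → h i x)
sum1-∑ zero    xs h = sym (∑-zero xs (λ _ → refl))
sum1-∑ (suc k) xs h = trans (cong (_+ ∑ xs (h (suc k))) (sum1-∑ k xs h)) (sym (∑-distrib-+ xs _ (h (suc k))))

sum1-zero : (k : ℕ) (f : ℕ → ℕ) → (∀ i → 1 ≤ i → i ≤ k → f i ≡ 0) → sum1 k f ≡ 0
sum1-zero zero    f f≗0 = refl
sum1-zero (suc k) f f≗0 = cong₂ _+_ (sum1-zero k f (λ i 1≤i i≤k → f≗0 i 1≤i (m≤n⇒m≤1+n i≤k)))
                                    (f≗0 (suc k) (s≤s z≤n) ≤-refl)

sum1-∉ : (k : ℕ) (f : ℕ → ℕ) {j : ℕ} → (∀ i → 1 ≤ i → i ≤ k → j ≢ i) →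
         sum1 k (λ i → f i * 𝟙 (does (j ≟ i))) ≡ 0
sum1-∉ k f {j} j∉ = sum1-zero k _ (λ i 1≤i i≤k →
  trans (cong (λ b → f i * 𝟙 b) (dec-false (j ≟ i) (j∉ i 1≤i i≤k))) (*-zeroʳ (f i)))

sum1-∈ : (k : ℕ) (f : ℕ → ℕ) {j : ℕ} → 1 ≤ j → j ≤ k → sum1 k (λ i → f i * 𝟙 (does (j ≟ i))) ≡ f j
sum1-∈ zero    f (s≤s _) ()
sum1-∈ (suc k) f {j} 1≤j j≤1+k with j ≟ suc k
... | yes refl = cong₂ _+_ (sum1-∉ k f (λ i _ i≤k j≡i → 1+n≰n (subst (_≤ k) (sym j≡i) i≤k)))
                           (trans (cong (λ b → f j * 𝟙 b) (dec-true (j ≟ j) refl)) (*-identityʳ (f j)))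
... | no j≢1+k =
  trans (cong₂ _+_ (sum1-∈ k f 1≤j (≤-pred (≤∧≢⇒< j≤1+k j≢1+k))) last≡0) (+-identityʳ (f j))
  where
  last≡0 : f (suc k) * 𝟙 (does (j ≟ suc k)) ≡ 0
  last≡0 = trans (cong (λ b → f (suc k) * 𝟙 b) (dec-false (j ≟ suc k) j≢1+k)) (*-zeroʳ (f (suc k)))

sum1-select : (k : ℕ) (f : ℕ → ℕ) → f 0 ≡ 0 → (∀ i → k < i → f i ≡ 0) →
              ∀ j → sum1 k (λ i → f i * 𝟙 (does (j ≟ i))) ≡ f j
sum1-select k f f0≡0 f>k≡0 zero = trans (sum1-∉ k f {0} (λ { _ (s≤s _) _ () })) (sym f0≡0)
sum1-select k f f0≡0 f>k≡0 (suc j) with suc j ≤? k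
... | yes 1+j≤k = sum1-∈ k f (s≤s z≤n) 1+j≤k
... | no 1+j≰k  = trans (sum1-∉ k f (λ i _ i≤k j≡i → 1+j≰k (subst (_≤ k) (sym j≡i) i≤k)))
                        (sym (f>k≡0 (suc j) (≰⇒> 1+j≰k)))

size : {N : ℕ} → Vec Bool N → ℕ
size []      = 0
size (b ∷ M) = 𝟙 b + size M

∑-allVec-suc : (N : ℕ) (h : Vec Bool (suc N) → ℕ) →
               ∑ (allVec (suc N)) h ≡ ∑[ M ∈ allVec N ] h (false ∷ M) + ∑[ M ∈ allVec N ] h (true ∷ M)
∑-allVec-suc N h = trans (∑-++ (map (false ∷_) (allVec N)) _ h)
                         (cong₂ _+_ (∑-map (false ∷_) (allVec N) h) (∑-map (true ∷_) (allVec N) h))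

∑-allVec-1 : (N : ℕ) → ∑[ M ∈ allVec N ] 1 ≡ 2 ^ N
∑-allVec-1 zero    = refl
∑-allVec-1 (suc N) = begin
  ∑[ M ∈ allVec (suc N) ] 1                  ≡⟨ ∑-allVec-suc N _ ⟩
  ∑[ M ∈ allVec N ] 1 + ∑[ M ∈ allVec N ] 1  ≡⟨ cong (λ n → n + n) (∑-allVec-1 N) ⟩
  2 ^ N + 2 ^ N                              ≡⟨ cong (2 ^ N +_) (sym (+-identityʳ (2 ^ N))) ⟩
  2 ^ suc N                                  ∎
  where open ≡-Reasoning

_≟ᵥ_ : {k : ℕ} → DecidableEquality (Vec Bool k)
_≟ᵥ_ = ≡-dec Bool._≟_

∑-allVec-≟ : (N : ℕ) (x : Vec Bool N) → ∑[ r ∈ allVec N ] 𝟙 (does (r ≟ᵥ x)) ≡ 1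
∑-allVec-≟ zero    []          = refl
∑-allVec-≟ (suc N) (false ∷ x) =
  trans (∑-allVec-suc N _) (cong₂ _+_ (∑-allVec-≟ N x) (∑-zero (allVec N) (λ _ → refl)))
∑-allVec-≟ (suc N) (true ∷ x)  =
  trans (∑-allVec-suc N _) (cong₂ _+_ (∑-zero (allVec N) (λ _ → refl)) (∑-allVec-≟ N x))

∑-size≡0 : (N : ℕ) (g : Vec Bool N → ℕ) →
           ∑[ M ∈ allVec N ] 𝟙 (does (size M ≟ 0)) * g M ≡ g (replicate N false)
∑-size≡0 zero    g = trans (+-identityʳ _) (+-identityʳ _)
∑-size≡0 (suc N) g = begin
  ∑[ M ∈ allVec (suc N) ] 𝟙 (does (size M ≟ 0)) * g M
    ≡⟨ ∑-allVec-suc N _ ⟩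
  ∑[ M ∈ allVec N ] 𝟙 (does (size M ≟ 0)) * g (false ∷ M) + ∑[ M ∈ allVec N ] 0
    ≡⟨ cong₂ _+_ (∑-size≡0 N (g ∘ (false ∷_))) (∑-zero (allVec N) (λ _ → refl)) ⟩
  g (false ∷ replicate N false) + 0
    ≡⟨ +-identityʳ _ ⟩
  g (replicate (suc N) false) ∎
  where open ≡-Reasoning

∑-allFin-suc : (N : ℕ) (h : Fin (suc N) → ℕ) → ∑ (allFin (suc N)) h ≡ h zero + ∑[ x ∈ allFin N ] h (suc x)
∑-allFin-suc N h = cong (h zero +_) (trans (cong (λ xs → ∑ xs h) (sym (map-tabulate id suc))) (∑-map suc (allFin N) h))

∑-lookup≡size : {N : ℕ} (M : Vec Bool N) → ∑[ x ∈ allFin N ] 𝟙 (lookup M x) ≡ size M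
∑-lookup≡size []            = refl
∑-lookup≡size {suc N} (b ∷ M) = trans (∑-allFin-suc N _) (cong (𝟙 b +_) (∑-lookup≡size M))

size-[]≔false : {N : ℕ} (M : Vec Bool N) (x : Fin N) → lookup M x ≡ true → size M ≡ suc (size (M [ x ]≔ false))
size-[]≔false (true ∷ M) zero    refl = refl
size-[]≔false (b ∷ M)    (suc x) Mx   = trans (cong (𝟙 b +_) (size-[]≔false M x Mx)) (+-suc (𝟙 b) _)

-- M ↦ M [ x ]≔ true is two-to-one onto the sets containing x, with fibre {M, M [ x ]≔ false}.
∑-[]≔true : (N : ℕ) (F w : Vec Bool N → ℕ) (x : Fin N) →
            ∑[ M ∈ allVec N ] F M * w (M [ x ]≔ true) ≡
            ∑[ M ∈ allVec N ] 𝟙 (lookup M x) * (F M + F (M [ x ]≔ false)) * w M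
∑-[]≔true (suc N) F w zero = begin
  ∑[ M ∈ allVec (suc N) ] F M * w (M [ zero ]≔ true)
    ≡⟨ ∑-allVec-suc N _ ⟩
  ∑[ M ∈ allVec N ] F (false ∷ M) * w (true ∷ M) + ∑[ M ∈ allVec N ] F (true ∷ M) * w (true ∷ M)
    ≡⟨ +-comm (∑[ M ∈ allVec N ] F (false ∷ M) * w (true ∷ M)) _ ⟩
  ∑[ M ∈ allVec N ] F (true ∷ M) * w (true ∷ M) + ∑[ M ∈ allVec N ] F (false ∷ M) * w (true ∷ M)
    ≡⟨ sym (∑-distrib-+ (allVec N) _ _) ⟩
  ∑[ M ∈ allVec N ] (F (true ∷ M) * w (true ∷ M) + F (false ∷ M) * w (true ∷ M))
    ≡⟨ ∑-cong (allVec N) (λ M → sym (*-distribʳ-+ (w (true ∷ M)) (F (true ∷ M)) (F (false ∷ M)))) ⟩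
  ∑[ M ∈ allVec N ] (F (true ∷ M) + F (false ∷ M)) * w (true ∷ M)
    ≡⟨ ∑-cong (allVec N) (λ M → cong (_* w (true ∷ M)) (sym (*-identityˡ (F (true ∷ M) + F (false ∷ M))))) ⟩
  ∑[ M ∈ allVec N ] 1 * (F (true ∷ M) + F (false ∷ M)) * w (true ∷ M)
    ≡⟨ cong (_+ ∑[ M ∈ allVec N ] 1 * (F (true ∷ M) + F (false ∷ M)) * w (true ∷ M))
            (sym (∑-zero (allVec N) (λ _ → refl))) ⟩
  ∑[ M ∈ allVec N ] 0 + ∑[ M ∈ allVec N ] 1 * (F (true ∷ M) + F (false ∷ M)) * w (true ∷ M)
    ≡⟨ sym (∑-allVec-suc N _) ⟩
  ∑[ M ∈ allVec (suc N) ] 𝟙 (lookup M zero) * (F M + F (M [ zero ]≔ false)) * w M ∎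
  where open ≡-Reasoning
∑-[]≔true (suc N) F w (suc x) = begin
  ∑[ M ∈ allVec (suc N) ] F M * w (M [ suc x ]≔ true)
    ≡⟨ ∑-allVec-suc N _ ⟩
  ∑[ M ∈ allVec N ] F (false ∷ M) * w (false ∷ M [ x ]≔ true)
    + ∑[ M ∈ allVec N ] F (true ∷ M) * w (true ∷ M [ x ]≔ true)
    ≡⟨ cong₂ _+_ (∑-[]≔true N (F ∘ (false ∷_)) (w ∘ (false ∷_)) x)
                 (∑-[]≔true N (F ∘ (true ∷_)) (w ∘ (true ∷_)) x) ⟩
  ∑[ M ∈ allVec N ] 𝟙 (lookup M x) * (F (false ∷ M) + F (false ∷ M [ x ]≔ false)) * w (false ∷ M)
    + ∑[ M ∈ allVec N ] 𝟙 (lookup M x) * (F (true ∷ M) + F (true ∷ M [ x ]≔ false)) * w (true ∷ M)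
    ≡⟨ sym (∑-allVec-suc N _) ⟩
  ∑[ M ∈ allVec (suc N) ] 𝟙 (lookup M (suc x)) * (F M + F (M [ suc x ]≔ false)) * w M ∎
  where open ≡-Reasoning

surjections : ℕ → ℕ → ℕ
surjections k i = i ! * S₂ k i

<⇒S₂≡0 : {k i : ℕ} → k < i → S₂ k i ≡ 0
<⇒S₂≡0 {zero}  {suc i} _           = refl
<⇒S₂≡0 {suc k} {suc i} (s≤s k<i) =
  trans (cong₂ (λ a b → suc i * a + b) (<⇒S₂≡0 (m<n⇒m<1+n k<i)) (<⇒S₂≡0 k<i))
        (trans (+-identityʳ _) (*-zeroʳ (suc i)))

surjections-vanish : {k i : ℕ} → k < i → surjections k i ≡ 0
surjections-vanish {i = i} k<i = trans (cong (i ! *_) (<⇒S₂≡0 k<i)) (*-zeroʳ (i !))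

surjections-zeroˡ : (c : ℕ) → surjections 0 c ≡ 𝟙 (does (c ≟ 0))
surjections-zeroˡ zero    = refl
surjections-zeroˡ (suc c) = *-zeroʳ (suc c !)

-- A surjection from a (k+1)-set onto a c-set sends the new point to one of the c values
-- and restricts to a surjection onto either all c values or the other c − 1.
surjections-suc : (k c : ℕ) → c * (surjections k c + surjections k (pred c)) ≡ surjections (suc k) c
surjections-suc k zero    = refl
surjections-suc k (suc c) =
  solve 4 (λ c c! s₁ s₀ → (con 1 :+ c) :* ((con 1 :+ c) :* c! :* s₁ :+ c! :* s₀)
                        := (con 1 :+ c) :* c! :* ((con 1 :+ c) :* s₁ :+ s₀))
        refl c (c !) (S₂ k (suc c)) (S₂ k c)
  where open +-*-Solver

∑-removals : (f : ℕ → ℕ) {N : ℕ} (M : Vec Bool N) →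
             ∑[ x ∈ allFin N ] 𝟙 (lookup M x) * (f (size M) + f (size (M [ x ]≔ false)))
             ≡ size M * (f (size M) + f (pred (size M)))
∑-removals f {N} M = begin
  ∑[ x ∈ allFin N ] 𝟙 (lookup M x) * (f (size M) + f (size (M [ x ]≔ false)))
    ≡⟨ ∑-cong (allFin N) removal ⟩
  ∑[ x ∈ allFin N ] 𝟙 (lookup M x) * (f (size M) + f (pred (size M)))
    ≡⟨ ∑-*ʳ _ (allFin N) _ ⟩
  (∑[ x ∈ allFin N ] 𝟙 (lookup M x)) * (f (size M) + f (pred (size M)))
    ≡⟨ cong (_* (f (size M) + f (pred (size M)))) (∑-lookup≡size M) ⟩
  size M * (f (size M) + f (pred (size M))) ∎
  where
  open ≡-Reasoning
  removal : ∀ x → 𝟙 (lookup M x) * (f (size M) + f (size (M [ x ]≔ false)))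
                  ≡ 𝟙 (lookup M x) * (f (size M) + f (pred (size M)))
  removal x with lookup M x in Mx
  ... | false = refl
  ... | true  = cong (λ n → 1 * (f (size M) + f n)) (sym (cong pred (size-[]≔false M x Mx)))

tuples : {A : Set} → List A → (k : ℕ) → List (Vec A k)
tuples xs zero    = [ [] ]
tuples xs (suc k) = concatMap (λ x → map (x ∷_) (tuples xs k)) xs

∑-tuples-suc : {A : Set} (xs : List A) (k : ℕ) (h : Vec A (suc k) → ℕ) →
               ∑ (tuples xs (suc k)) h ≡ ∑[ x ∈ xs ] ∑[ t ∈ tuples xs k ] h (x ∷ t)
∑-tuples-suc xs k h = trans (∑-concatMap _ xs h) (∑-cong xs (λ x → ∑-map (x ∷_) (tuples xs k) h))

∑-tuples-singleton : {A : Set} (a : A) (k : ℕ) (h : Vec A k → ℕ) → ∑ (tuples [ a ] k) h ≡ h (replicate k a)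
∑-tuples-singleton a zero    h = +-identityʳ _
∑-tuples-singleton a (suc k) h =
  trans (∑-tuples-suc [ a ] k h) (trans (+-identityʳ _) (∑-tuples-singleton a k (h ∘ (a ∷_))))

∑-tuples-map : {A B : Set} (g : A → B) (xs : List A) (k : ℕ) (h : Vec B k → ℕ) →
               ∑ (tuples (map g xs) k) h ≡ ∑[ t ∈ tuples xs k ] h (Vec.map g t)
∑-tuples-map g xs zero    h = refl
∑-tuples-map g xs (suc k) h = begin
  ∑ (tuples (map g xs) (suc k)) h
    ≡⟨ ∑-tuples-suc (map g xs) k h ⟩
  ∑[ y ∈ map g xs ] ∑[ t ∈ tuples (map g xs) k ] h (y ∷ t)
    ≡⟨ ∑-map g xs _ ⟩
  ∑[ x ∈ xs ] ∑[ t ∈ tuples (map g xs) k ] h (g x ∷ t)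
    ≡⟨ ∑-cong xs (λ x → ∑-tuples-map g xs k (h ∘ (g x ∷_))) ⟩
  ∑[ x ∈ xs ] ∑[ t ∈ tuples xs k ] h (g x ∷ Vec.map g t)
    ≡⟨ sym (∑-tuples-suc xs k _) ⟩
  ∑[ t ∈ tuples xs (suc k) ] h (Vec.map g t) ∎
  where open ≡-Reasoning

image : {N k : ℕ} → Vec (Fin N) k → Vec Bool N
image []      = replicate _ false
image (x ∷ t) = image t [ x ]≔ true

∑-tuples-image : (N k : ℕ) (w : Vec Bool N → ℕ) →
                 ∑[ t ∈ tuples (allFin N) k ] w (image t) ≡ ∑[ M ∈ allVec N ] surjections k (size M) * w M
∑-tuples-image N zero w = begin
  w (replicate N false) + 0
    ≡⟨ +-identityʳ _ ⟩
  w (replicate N false)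
    ≡⟨ sym (∑-size≡0 N w) ⟩
  ∑[ M ∈ allVec N ] 𝟙 (does (size M ≟ 0)) * w M
    ≡⟨ ∑-cong (allVec N) (λ M → cong (_* w M) (sym (surjections-zeroˡ (size M)))) ⟩
  ∑[ M ∈ allVec N ] surjections 0 (size M) * w M ∎
  where open ≡-Reasoning
∑-tuples-image N (suc k) w = begin
  ∑[ t ∈ tuples (allFin N) (suc k) ] w (image t)
    ≡⟨ ∑-tuples-suc (allFin N) k _ ⟩
  ∑[ x ∈ allFin N ] ∑[ t ∈ tuples (allFin N) k ] w (image t [ x ]≔ true)
    ≡⟨ ∑-cong (allFin N) (λ x → ∑-tuples-image N k (λ M → w (M [ x ]≔ true))) ⟩
  ∑[ x ∈ allFin N ] ∑[ M ∈ allVec N ] s (size M) * w (M [ x ]≔ true)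
    ≡⟨ ∑-cong (allFin N) (∑-[]≔true N (s ∘ size) w) ⟩
  ∑[ x ∈ allFin N ] ∑[ M ∈ allVec N ] 𝟙 (lookup M x) * (s (size M) + s (size (M [ x ]≔ false))) * w M
    ≡⟨ ∑-comm (allFin N) (allVec N) _ ⟩
  ∑[ M ∈ allVec N ] ∑[ x ∈ allFin N ] 𝟙 (lookup M x) * (s (size M) + s (size (M [ x ]≔ false))) * w M
    ≡⟨ ∑-cong (allVec N) (λ M → ∑-*ʳ (w M) (allFin N) _) ⟩
  ∑[ M ∈ allVec N ] (∑[ x ∈ allFin N ] 𝟙 (lookup M x) * (s (size M) + s (size (M [ x ]≔ false)))) * w M
    ≡⟨ ∑-cong (allVec N) (λ M → cong (_* w M) (trans (∑-removals s M) (surjections-suc k (size M)))) ⟩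
  ∑[ M ∈ allVec N ] surjections (suc k) (size M) * w M ∎
  where
  open ≡-Reasoning
  s : ℕ → ℕ
  s = surjections k

select : {A : Set} (xs : List A) → Vec Bool (length xs) → List A
select []       []          = []
select (x ∷ xs) (true ∷ M)  = x ∷ select xs M
select (x ∷ xs) (false ∷ M) = select xs M

select-∅ : {A : Set} (xs : List A) → select xs (replicate (length xs) false) ≡ []
select-∅ []       = refl
select-∅ (x ∷ xs) = select-∅ xs

∈-select⁻ : {A : Set} (xs : List A) (M : Vec Bool (length xs)) {y : A} →
            y ∈ select xs M → ∃[ x ] lookup M x ≡ true × y ≡ List.lookup xs x
∈-select⁻ []       []          ()
∈-select⁻ (a ∷ xs) (true ∷ M)  (here refl) = zero , refl , refl
∈-select⁻ (a ∷ xs) (true ∷ M)  (there y∈)  with ∈-select⁻ xs M y∈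
... | x , Mx , y≡ = suc x , Mx , y≡
∈-select⁻ (a ∷ xs) (false ∷ M) y∈          with ∈-select⁻ xs M y∈
... | x , Mx , y≡ = suc x , Mx , y≡

∈-select⁺ : {A : Set} (xs : List A) (M : Vec Bool (length xs)) (x : Fin (length xs)) →
            lookup M x ≡ true → List.lookup xs x ∈ select xs M
∈-select⁺ (a ∷ xs) (true ∷ M)  zero    _  = here refl
∈-select⁺ (a ∷ xs) (true ∷ M)  (suc x) Mx = there (∈-select⁺ xs M x Mx)
∈-select⁺ (a ∷ xs) (false ∷ M) (suc x) Mx = ∈-select⁺ xs M x Mx

∑-combinations : {A : Set} (i : ℕ) (xs : List A) (g : List A → ℕ) →
                 ∑ (combinations i xs) g ≡ ∑[ M ∈ allVec (length xs) ] 𝟙 (does (size M ≟ i)) * g (select xs M)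
∑-combinations zero    xs       g =
  trans (+-identityʳ _) (sym (trans (∑-size≡0 (length xs) (g ∘ select xs)) (cong g (select-∅ xs))))
∑-combinations (suc i) []       g = refl
∑-combinations (suc i) (x ∷ xs) g = begin
  ∑ (map (x ∷_) (combinations i xs) ++ combinations (suc i) xs) g
    ≡⟨ ∑-++ (map (x ∷_) (combinations i xs)) _ g ⟩
  ∑ (map (x ∷_) (combinations i xs)) g + ∑ (combinations (suc i) xs) g
    ≡⟨ cong (_+ ∑ (combinations (suc i) xs) g) (∑-map (x ∷_) (combinations i xs) g) ⟩
  ∑[ c ∈ combinations i xs ] g (x ∷ c) + ∑ (combinations (suc i) xs) g
    ≡⟨ cong₂ _+_ (∑-combinations i xs (g ∘ (x ∷_))) (∑-combinations (suc i) xs g) ⟩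
  with-x + without-x
    ≡⟨ +-comm with-x without-x ⟩
  without-x + with-x
    ≡⟨ sym (∑-allVec-suc (length xs) _) ⟩
  ∑[ M ∈ allVec (length (x ∷ xs)) ] 𝟙 (does (size M ≟ suc i)) * g (select (x ∷ xs) M) ∎
  where
  open ≡-Reasoning
  with-x without-x : ℕ
  with-x    = ∑[ M ∈ allVec (length xs) ] 𝟙 (does (size M ≟ i)) * g (x ∷ select xs M)
  without-x = ∑[ M ∈ allVec (length xs) ] 𝟙 (does (size M ≟ suc i)) * g (select xs M)

lookup-image⁺ : {N k : ℕ} (t : Vec (Fin N) k) {x : Fin N} → x ∈ᵥ t → lookup (image t) x ≡ true
lookup-image⁺ (y ∷ t)     (hereᵥ refl)  = lookup∘update y (image t) true
lookup-image⁺ (y ∷ t) {x} (thereᵥ x∈t) with y Fin.≟ x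
... | yes refl = lookup∘update y (image t) true
... | no y≢x   = trans (lookup∘update′ (≢-sym y≢x) (image t) true) (lookup-image⁺ t x∈t)

lookup-image⁻ : {N k : ℕ} (t : Vec (Fin N) k) (x : Fin N) → lookup (image t) x ≡ true → x ∈ᵥ t
lookup-image⁻ []      x ∅x≡true with trans (sym ∅x≡true) (lookup-replicate x false)
... | ()
lookup-image⁻ (y ∷ t) x tx≡true with y Fin.≟ x
... | yes refl = hereᵥ refl
... | no y≢x   = thereᵥ (lookup-image⁻ t x (trans (sym (lookup∘update′ (≢-sym y≢x) (image t) true)) tx≡true))

module _ {A : Set} (xs : List A) {k : ℕ} (t : Vec (Fin (length xs)) k) where

  select-image⊆ : select xs (image t) ⊆ toList (Vec.map (List.lookup xs) t)
  select-image⊆ y∈ with ∈-select⁻ xs (image t) y∈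
  ... | x , x∈image , refl = ∈-toList⁺ (∈-map⁺ (List.lookup xs) (lookup-image⁻ t x x∈image))

  select-image⊇ : toList (Vec.map (List.lookup xs) t) ⊆ select xs (image t)
  select-image⊇ y∈ with ∈-map⁻ (List.lookup xs) (subst (_ ∈_) (toList-map (List.lookup xs) t) y∈)
  ... | x , x∈t , refl = ∈-select⁺ xs (image t) x (lookup-image⁺ t (∈-toList⁻ x∈t))

χ-separating : {m : ℕ} → List (Bip m) → ℕ
χ-separating F = 𝟙 (does (separating? F))

Separating-resp-⊆ : {m : ℕ} {F G : List (Bip m)} → F ⊆ G → Separating F → Separating G
Separating-resp-⊆ F⊆G sepF x y x≢y = Any-resp-⊆ F⊆G (sepF x y x≢y)

χ-separating-resp-⊆⊇ : {m : ℕ} {F G : List (Bip m)} → F ⊆ G → G ⊆ F → χ-separating F ≡ χ-separating G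
χ-separating-resp-⊆⊇ {F = F} {G} F⊆G G⊆F =
  cong 𝟙 (does-⇔ (mk⇔ (Separating-resp-⊆ F⊆G) (Separating-resp-⊆ G⊆F)) (separating? F) (separating? G))

∑-tuples-select-image : {m : ℕ} (L : List (Bip m)) (k : ℕ) →
  ∑[ t ∈ tuples (allFin (length L)) k ] χ-separating (select L (image t)) ≡ ∑[ T ∈ tuples L k ] χ-separating (toList T)
∑-tuples-select-image L k = begin
  ∑[ t ∈ tuples (allFin (length L)) k ] χ-separating (select L (image t))
    ≡⟨ ∑-cong (tuples (allFin (length L)) k)
              (λ t → χ-separating-resp-⊆⊇ (select-image⊆ L t) (select-image⊇ L t)) ⟩
  ∑[ t ∈ tuples (allFin (length L)) k ] χ-separating (toList (Vec.map (List.lookup L) t))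
    ≡⟨ sym (∑-tuples-map (List.lookup L) (allFin (length L)) k (χ-separating ∘ toList)) ⟩
  ∑[ T ∈ tuples (map (List.lookup L) (allFin (length L))) k ] χ-separating (toList T)
    ≡⟨ cong (λ xs → ∑[ T ∈ tuples xs k ] χ-separating (toList T))
            (trans (map-tabulate id (List.lookup L)) (tabulate-lookup L)) ⟩
  ∑[ T ∈ tuples L k ] χ-separating (toList T) ∎
  where open ≡-Reasoning

_∈?ᵥ_ : {k : ℕ} (r : Vec Bool k) (D : List (Vec Bool k)) → Dec (r ∈ D)
_∈?ᵥ_ = DecMembership._∈?_ _≟ᵥ_

_∉?ᵥ_ : {k : ℕ} (r : Vec Bool k) (D : List (Vec Bool k)) → Dec (r ∉ D)
_∉?ᵥ_ = DecMembership._∉?_ _≟ᵥ_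

∑-allVec-∈ : {k : ℕ} (D : List (Vec Bool k)) → Unique D → ∑[ r ∈ allVec k ] 𝟙 (does (r ∈?ᵥ D)) ≡ length D
∑-allVec-∈ {k} []      _              = ∑-zero (allVec k) (λ _ → refl)
∑-allVec-∈ {k} (x ∷ D) (x≢D ∷ uniqueD) = begin
  ∑[ r ∈ allVec k ] 𝟙 (does (r ∈?ᵥ (x ∷ D)))
    ≡⟨ ∑-cong (allVec k) split ⟩
  ∑[ r ∈ allVec k ] (𝟙 (does (r ≟ᵥ x)) + 𝟙 (does (r ∈?ᵥ D)))
    ≡⟨ ∑-distrib-+ (allVec k) _ _ ⟩
  ∑[ r ∈ allVec k ] 𝟙 (does (r ≟ᵥ x)) + ∑[ r ∈ allVec k ] 𝟙 (does (r ∈?ᵥ D))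
    ≡⟨ cong₂ _+_ (∑-allVec-≟ k x) (∑-allVec-∈ D uniqueD) ⟩
  suc (length D) ∎
  where
  open ≡-Reasoning
  split : ∀ r → 𝟙 (does (r ≟ᵥ x) ∨ does (r ∈?ᵥ D)) ≡ 𝟙 (does (r ≟ᵥ x)) + 𝟙 (does (r ∈?ᵥ D))
  split r with r ≟ᵥ x
  ... | yes refl = cong (suc ∘ 𝟙) (sym (dec-false (r ∈?ᵥ D) (All¬⇒¬Any x≢D)))
  ... | no _     = refl

∑-allVec-∉ : {k : ℕ} (D : List (Vec Bool k)) → Unique D →
             ∑[ r ∈ allVec k ] 𝟙 (does (r ∉?ᵥ D)) ≡ 2 ^ k ∸ length D
∑-allVec-∉ {k} D uniqueD = begin
  outside
    ≡⟨ sym (m+n∸n≡m outside (length D)) ⟩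
  outside + length D ∸ length D
    ≡⟨ cong (λ n → outside + n ∸ length D) (sym (∑-allVec-∈ D uniqueD)) ⟩
  outside + ∑[ r ∈ allVec k ] 𝟙 (does (r ∈?ᵥ D)) ∸ length D
    ≡⟨ cong (_∸ length D) (sym (∑-distrib-+ (allVec k) _ _)) ⟩
  ∑[ r ∈ allVec k ] (𝟙 (does (r ∉?ᵥ D)) + 𝟙 (does (r ∈?ᵥ D))) ∸ length D
    ≡⟨ cong (_∸ length D) (∑-cong (allVec k) (λ r → 𝟙-not+𝟙 (does (r ∈?ᵥ D)))) ⟩
  ∑[ r ∈ allVec k ] 1 ∸ length D
    ≡⟨ cong (_∸ length D) (∑-allVec-1 k) ⟩
  2 ^ k ∸ length D ∎
  where
  open ≡-Reasoning
  outside : ℕ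
  outside = ∑[ r ∈ allVec k ] 𝟙 (does (r ∉?ᵥ D))
  𝟙-not+𝟙 : (b : Bool) → 𝟙 (not b) + 𝟙 b ≡ 1
  𝟙-not+𝟙 true  = refl
  𝟙-not+𝟙 false = refl

row : {m k : ℕ} → Fin (suc m) → Vec (Bip m) k → Vec Bool k
row x T = Vec.map (λ b → side b x) T

rows : {m k : ℕ} → Vec (Bip m) k → List (Vec Bool k)
rows T = tabulate (λ x → row x T)

module _ {B : Set} (f g : B → Bool) where

  Any-≢⇒map-≢ : {k : ℕ} (T : Vec B k) → Any (λ b → f b ≢ g b) (toList T) → Vec.map f T ≢ Vec.map g T
  Any-≢⇒map-≢ (b ∷ T) (here fb≢gb) fT≡gT = fb≢gb (∷-injectiveˡ fT≡gT)
  Any-≢⇒map-≢ (b ∷ T) (there any≢) fT≡gT = Any-≢⇒map-≢ T any≢ (∷-injectiveʳ fT≡gT)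

  map-≢⇒Any-≢ : {k : ℕ} (T : Vec B k) → Vec.map f T ≢ Vec.map g T → Any (λ b → f b ≢ g b) (toList T)
  map-≢⇒Any-≢ []      fT≢gT = ⊥-elim (fT≢gT refl)
  map-≢⇒Any-≢ (b ∷ T) fT≢gT with f b Bool.≟ g b
  ... | no fb≢gb  = here fb≢gb
  ... | yes fb≡gb = there (map-≢⇒Any-≢ T (fT≢gT ∘ cong₂ _∷_ fb≡gb))

module _ {m k : ℕ} (T : Vec (Bip m) k) where

  separating⇒row-injective : Separating (toList T) → Injective _≡_ _≡_ (λ x → row x T)
  separating⇒row-injective sep {x} {y} rx≡ry with x Fin.≟ y
  ... | yes x≡y = x≡y
  ... | no x≢y  = ⊥-elim (Any-≢⇒map-≢ _ _ T (sep x y x≢y) rx≡ry)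

  row-injective⇒separating : Injective _≡_ _≡_ (λ x → row x T) → Separating (toList T)
  row-injective⇒separating inj x y x≢y = map-≢⇒Any-≢ _ _ T (x≢y ∘ inj)

-- The new element of Fin (suc (suc m)) is suc zero; r records its side in each bipartition.
extend : {m k : ℕ} → Vec Bool k → Vec (Bip m) k → Vec (Bip (suc m)) k
extend = zipWith _∷_

data NewOrOld {m : ℕ} : Fin (suc (suc m)) → Set where
  new : NewOrOld (suc zero)
  old : (x : Fin (suc m)) → NewOrOld (punchIn (suc zero) x)

newOrOld : {m : ℕ} (x : Fin (suc (suc m))) → NewOrOld x
newOrOld zero          = old zero
newOrOld (suc zero)    = new
newOrOld (suc (suc x)) = old (suc x)

module _ {m : ℕ} where

  row-extend-new : {k : ℕ} (r : Vec Bool k) (T : Vec (Bip m) k) → row (suc zero) (extend r T) ≡ r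
  row-extend-new []      []      = refl
  row-extend-new (a ∷ r) (b ∷ T) = cong (a ∷_) (row-extend-new r T)

  row-extend-old : {k : ℕ} (r : Vec Bool k) (T : Vec (Bip m) k) (x : Fin (suc m)) →
                   row (punchIn (suc zero) x) (extend r T) ≡ row x T
  row-extend-old []      []      x = refl
  row-extend-old (a ∷ r) (b ∷ T) x = cong₂ _∷_ (side-old x) (row-extend-old r T x)
    where
    side-old : (x : Fin (suc m)) → side (a ∷ b) (punchIn (suc zero) x) ≡ side b x
    side-old zero    = refl
    side-old (suc x) = refl

module _ {m k : ℕ} (r : Vec Bool k) (T : Vec (Bip m) k) where

  extend-injective⇒injective : Injective _≡_ _≡_ (λ x → row x (extend r T)) → Injective _≡_ _≡_ (λ x → row x T)
  extend-injective⇒injective inj {x} {y} rx≡ry = Fin.punchIn-injective (suc zero) x y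
    (inj (trans (row-extend-old r T x) (trans rx≡ry (sym (row-extend-old r T y)))))

  extend-injective⇒∉ : Injective _≡_ _≡_ (λ x → row x (extend r T)) → r ∉ rows T
  extend-injective⇒∉ inj r∈rows with ∈-tabulate⁻ r∈rows
  ... | x , r≡rx = Fin.punchInᵢ≢i (suc zero) x
    (sym (inj (trans (row-extend-new r T) (trans r≡rx (sym (row-extend-old r T x))))))

  ∉-rows⇒≢-row : r ∉ rows T → ∀ z → r ≢ row z T
  ∉-rows⇒≢-row r∉rows z r≡rz = r∉rows (subst (_∈ rows T) (sym r≡rz) (∈-tabulate⁺ {f = λ x → row x T} z))

  injective-∉⇒extend-injective : Injective _≡_ _≡_ (λ x → row x T) → r ∉ rows T →
                                 Injective _≡_ _≡_ (λ x → row x (extend r T))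
  injective-∉⇒extend-injective inj r∉rows {x} {y} rx≡ry with newOrOld x | newOrOld y
  ... | new    | new    = refl
  ... | new    | old y′ = ⊥-elim (∉-rows⇒≢-row r∉rows y′
    (trans (sym (row-extend-new r T)) (trans rx≡ry (row-extend-old r T y′))))
  ... | old x′ | new    = ⊥-elim (∉-rows⇒≢-row r∉rows x′
    (trans (sym (row-extend-new r T)) (trans (sym rx≡ry) (row-extend-old r T x′))))
  ... | old x′ | old y′ = cong (punchIn (suc zero))
    (inj (trans (sym (row-extend-old r T x′)) (trans rx≡ry (row-extend-old r T y′))))

  separating-extend⇔∉ : Separating (toList T) → Separating (toList (extend r T)) ⇔ r ∉ rows T
  separating-extend⇔∉ sepT = mk⇔
    (extend-injective⇒∉ ∘ separating⇒row-injective (extend r T))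
    (row-injective⇒separating (extend r T) ∘ injective-∉⇒extend-injective (separating⇒row-injective T sepT))

∑-extend-separating : (m k : ℕ) (T : Vec (Bip m) k) →
  ∑[ r ∈ allVec k ] χ-separating (toList (extend r T)) ≡ χ-separating (toList T) * (2 ^ k ∸ suc m)
∑-extend-separating m k T = by-cases (separating? (toList T))
  where
  open ≡-Reasoning
  by-cases : (sep? : Dec (Separating (toList T))) →
             ∑[ r ∈ allVec k ] χ-separating (toList (extend r T)) ≡ 𝟙 (does sep?) * (2 ^ k ∸ suc m)
  by-cases (no ¬sepT) = ∑-zero (allVec k) λ r → cong 𝟙 (dec-false (separating? _)
    (¬sepT ∘ row-injective⇒separating T ∘ extend-injective⇒injective r T ∘ separating⇒row-injective (extend r T)))
  by-cases (yes sepT) = begin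
    ∑[ r ∈ allVec k ] χ-separating (toList (extend r T))
      ≡⟨ ∑-cong (allVec k) (λ r →
           cong 𝟙 (does-⇔ (separating-extend⇔∉ r T sepT) (separating? _) (r ∉?ᵥ rows T))) ⟩
    ∑[ r ∈ allVec k ] 𝟙 (does (r ∉?ᵥ rows T))
      ≡⟨ ∑-allVec-∉ _ (tabulate⁺ (separating⇒row-injective T sepT)) ⟩
    2 ^ k ∸ length (rows T)
      ≡⟨ cong (2 ^ k ∸_) (length-tabulate (λ x → row x T)) ⟩
    2 ^ k ∸ suc m
      ≡⟨ sym (*-identityˡ (2 ^ k ∸ suc m)) ⟩
    1 * (2 ^ k ∸ suc m) ∎

∑-tuples-allVec-suc : (m k : ℕ) (h : Vec (Bip (suc m)) k → ℕ) →
  ∑ (tuples (allVec (suc m)) k) h ≡ ∑[ r ∈ allVec k ] ∑[ T ∈ tuples (allVec m) k ] h (extend r T)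
∑-tuples-allVec-suc m zero    h = sym (+-identityʳ _)
∑-tuples-allVec-suc m (suc k) h = begin
  ∑ (tuples (allVec (suc m)) (suc k)) h
    ≡⟨ ∑-tuples-suc (allVec (suc m)) k h ⟩
  ∑[ b ∈ allVec (suc m) ] ∑[ T ∈ tuples (allVec (suc m)) k ] h (b ∷ T)
    ≡⟨ ∑-allVec-suc m _ ⟩
  ∑[ b ∈ allVec m ] ∑[ T ∈ tuples (allVec (suc m)) k ] h ((false ∷ b) ∷ T)
    + ∑[ b ∈ allVec m ] ∑[ T ∈ tuples (allVec (suc m)) k ] h ((true ∷ b) ∷ T)
    ≡⟨ cong₂ _+_ (first-side false) (first-side true) ⟩
  ∑[ r ∈ allVec k ] ∑[ T ∈ tuples (allVec m) (suc k) ] h (extend (false ∷ r) T)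
    + ∑[ r ∈ allVec k ] ∑[ T ∈ tuples (allVec m) (suc k) ] h (extend (true ∷ r) T)
    ≡⟨ sym (∑-allVec-suc k _) ⟩
  ∑[ r ∈ allVec (suc k) ] ∑[ T ∈ tuples (allVec m) (suc k) ] h (extend r T) ∎
  where
  open ≡-Reasoning
  first-side : (a : Bool) →
    ∑[ b ∈ allVec m ] ∑[ T ∈ tuples (allVec (suc m)) k ] h ((a ∷ b) ∷ T)
    ≡ ∑[ r ∈ allVec k ] ∑[ T ∈ tuples (allVec m) (suc k) ] h (extend (a ∷ r) T)
  first-side a = begin
    ∑[ b ∈ allVec m ] ∑[ T ∈ tuples (allVec (suc m)) k ] h ((a ∷ b) ∷ T)
      ≡⟨ ∑-cong (allVec m) (λ b → ∑-tuples-allVec-suc m k (h ∘ ((a ∷ b) ∷_))) ⟩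
    ∑[ b ∈ allVec m ] ∑[ r ∈ allVec k ] ∑[ T ∈ tuples (allVec m) k ] h (extend (a ∷ r) (b ∷ T))
      ≡⟨ ∑-comm (allVec m) (allVec k) _ ⟩
    ∑[ r ∈ allVec k ] ∑[ b ∈ allVec m ] ∑[ T ∈ tuples (allVec m) k ] h (extend (a ∷ r) (b ∷ T))
      ≡⟨ ∑-cong (allVec k) (λ r → sym (∑-tuples-suc (allVec m) k _)) ⟩
    ∑[ r ∈ allVec k ] ∑[ T ∈ tuples (allVec m) (suc k) ] h (extend (a ∷ r) T) ∎

∑-separating-tuples : (m k : ℕ) →
  ∑[ T ∈ tuples (allVec m) k ] χ-separating (toList T) ≡ prod0 m (λ j → 2 ^ k ∸ suc j)
∑-separating-tuples zero    k = trans (∑-tuples-singleton [] k _)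
  (cong 𝟙 (dec-true (separating? (toList (replicate k []))) λ { zero zero 0≢0 → ⊥-elim (0≢0 refl) }))
∑-separating-tuples (suc m) k = begin
  ∑[ T ∈ tuples (allVec (suc m)) k ] χ-separating (toList T)
    ≡⟨ ∑-tuples-allVec-suc m k _ ⟩
  ∑[ r ∈ allVec k ] ∑[ T ∈ tuples (allVec m) k ] χ-separating (toList (extend r T))
    ≡⟨ ∑-comm (allVec k) (tuples (allVec m) k) _ ⟩
  ∑[ T ∈ tuples (allVec m) k ] ∑[ r ∈ allVec k ] χ-separating (toList (extend r T))
    ≡⟨ ∑-cong (tuples (allVec m) k) (∑-extend-separating m k) ⟩
  ∑[ T ∈ tuples (allVec m) k ] χ-separating (toList T) * (2 ^ k ∸ suc m)
    ≡⟨ ∑-*ʳ (2 ^ k ∸ suc m) (tuples (allVec m) k) _ ⟩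
  (∑[ T ∈ tuples (allVec m) k ] χ-separating (toList T)) * (2 ^ k ∸ suc m)
    ≡⟨ cong (_* (2 ^ k ∸ suc m)) (∑-separating-tuples m k) ⟩
  prod0 (suc m) (λ j → 2 ^ k ∸ suc j) ∎
  where open ≡-Reasoning

-- 1 ≤ k gives surjections k 0 ≡ 0, so the empty set, which sum1 (starting at i = 1) omits, contributes nothing.
sum1-surjections-by-size : {k : ℕ} → 1 ≤ k → (N : ℕ) (g : Vec Bool N → ℕ) →
  sum1 k (λ i → surjections k i * (∑[ M ∈ allVec N ] 𝟙 (does (size M ≟ i)) * g M))
  ≡ ∑[ M ∈ allVec N ] surjections k (size M) * g M
sum1-surjections-by-size {k@(suc _)} _ N g = begin
  sum1 k (λ i → surjections k i * (∑[ M ∈ allVec N ] 𝟙 (does (size M ≟ i)) * g M))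
    ≡⟨ sum1-cong k (λ i → sym (∑-*ˡ (surjections k i) (allVec N) _)) ⟩
  sum1 k (λ i → ∑[ M ∈ allVec N ] surjections k i * (𝟙 (does (size M ≟ i)) * g M))
    ≡⟨ sum1-∑ k (allVec N) _ ⟩
  ∑[ M ∈ allVec N ] sum1 k (λ i → surjections k i * (𝟙 (does (size M ≟ i)) * g M))
    ≡⟨ ∑-cong (allVec N) (λ M →
         trans (sum1-cong k (λ i → sym (*-assoc (surjections k i) (𝟙 (does (size M ≟ i))) (g M))))
               (sum1-*ʳ (g M) k _)) ⟩
  ∑[ M ∈ allVec N ] sum1 k (λ i → surjections k i * 𝟙 (does (size M ≟ i))) * g M
    ≡⟨ ∑-cong (allVec N) (λ M →
         cong (_* g M) (sum1-select k (surjections k) refl (λ _ → surjections-vanish) (size M))) ⟩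
  ∑[ M ∈ allVec N ] surjections k (size M) * g M ∎
  where open ≡-Reasoning

lemma3p7 : (m k : ℕ) → 1 ≤ m → 1 ≤ k → k ≤ 2 ^ m →
    sum1 k (λ i → (i !) * S₂ k i * τ m i) ≡ prod0 m (λ j → 2 ^ k ∸ suc j)
lemma3p7 m k _ 1≤k _ = begin
  sum1 k (λ i → surjections k i * τ m i)
    ≡⟨ sum1-cong k (λ i → cong (surjections k i *_) (τ-by-size i)) ⟩
  sum1 k (λ i → surjections k i * (∑[ M ∈ allVec N ] 𝟙 (does (size M ≟ i)) * χ-separating (select L M)))
    ≡⟨ sum1-surjections-by-size 1≤k N (χ-separating ∘ select L) ⟩
  ∑[ M ∈ allVec N ] surjections k (size M) * χ-separating (select L M)
    ≡⟨ sym (∑-tuples-image N k (χ-separating ∘ select L)) ⟩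
  ∑[ t ∈ tuples (allFin N) k ] χ-separating (select L (image t))
    ≡⟨ ∑-tuples-select-image L k ⟩
  ∑[ T ∈ tuples L k ] χ-separating (toList T)
    ≡⟨ ∑-separating-tuples m k ⟩
  prod0 m (λ j → 2 ^ k ∸ suc j) ∎
  where
  open ≡-Reasoning
  L : List (Bip m)
  L = allVec m
  N : ℕ
  N = length L
  τ-by-size : ∀ i → τ m i ≡ ∑[ M ∈ allVec N ] 𝟙 (does (size M ≟ i)) * χ-separating (select L M)
  τ-by-size i = trans (length-filter separating? (combinations i L)) (∑-combinations i L χ-separating)
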